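{- Let $H_{\aleph_0}$ be the graph defined below. For every automorphism $g$ of $H_{\aleph_0}$ and every connected component $C$ of $H_{\aleph_0}$, there exists a symplectic permutation $s$ of $\mathbb{Z}\setminus\{0\}$ such that $g(Y)=s(Y)$ for all vertices $Y\in C$. That is, the restriction of every automorphism of $H_{\aleph_0}$ to any connected component coincides with the restriction of some regular automorphism to that component.
   Context: A subset $X\subset\mathbb{Z}\setminus\{0\}$ is called singular if $i\in X$ implies $-i\notin X$; a maximal singular subset is one containing exactly one of $i,-i$ for every natural $i$. Two maximal singular subsets $X,Y$ are adjacent if $|X\setminus Y|=|Y\setminus X|=1$. The graph $H_{\aleph_0}$ has as vertices all maximal singular subsets of $\mathbb{Z}\setminus\{0\}$ and as edges the adjacent pairs. A permutation $s$ of $\mathbb{Z}\setminus\{0\}$ is symplectic if $s(-i)=-s(i)$ for all $i$; such a permutation maps maximal singular subsets to maximal singular subsets and induces an automorphism $X\mapsto s(X)$ of $H_{\aleph_0}$; automorphisms of this form are called regular. -}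

module Defs where

open import Data.Bool using (Bool; true; false)
open import Data.Integer using (ℤ; +_; +[1+_]; -[1+_]; -_; NonZero)
open import Data.Product using (Σ; _×_; _,_; ∃)
open import Data.Sum using (_⊎_)
open import Function.Bundles using (_↔_; Inverse)
open import Relation.Binary.PropositionalEquality using (_≡_)
open import Relation.Binary.Construct.Closure.ReflexiveTransitive using (Star)

NZ : Set
NZ = Σ ℤ NonZero

negNZ : NZ → NZ
negNZ (+[1+ n ] , _) = (-[1+ n ] , _)
negNZ (-[1+ n ] , _) = (+[1+ n ] , _)

Subset : Set
Subset = NZ → Bool

record Vertex : Set where
  field
    set      : Subset
    singular : ∀ i → set i ≡ true → set (negNZ i) ≡ false
    maximal  : ∀ i → set i ≡ true ⊎ set (negNZ i) ≡ true
open Vertex public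

_≈V_ : Vertex → Vertex → Set
X ≈V Y = ∀ i → set X i ≡ set Y i

DiffOne : Subset → Subset → Set
DiffOne A B = Σ NZ λ a → (A a ≡ true) × (B a ≡ false) ×
              (∀ b → A b ≡ true → B b ≡ false → b ≡ a)

Adj : Vertex → Vertex → Set
Adj X Y = DiffOne (set X) (set Y) × DiffOne (set Y) (set X)

Connected : Vertex → Vertex → Set
Connected = Star Adj

record Automorphism : Set where
  field
    to       : Vertex → Vertex
    from     : Vertex → Vertex
    to-cong  : ∀ {X Y} → X ≈V Y → to X ≈V to Y
    from-cong : ∀ {X Y} → X ≈V Y → from X ≈V from Y
    to-from  : ∀ X → to (from X) ≈V X
    from-to  : ∀ X → from (to X) ≈V X
    adj-pres : ∀ X Y → Adj X Y → Adj (to X) (to Y)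
    adj-refl : ∀ X Y → Adj (to X) (to Y) → Adj X Y
open Automorphism public

Symplectic : NZ ↔ NZ → Set
Symplectic s = ∀ i → Inverse.to s (negNZ i) ≡ negNZ (Inverse.to s i)

image : NZ ↔ NZ → Subset → Subset
image s Y j = Y (Inverse.from s j)

-- A maximal singular set is a choice of sign for each ±(n + 1), and two of them
-- are adjacent iff they differ in exactly one sign; the component of X₀ is thus a
-- hypercube of finite modifications of X₀. An automorphism g sends the neighbour
-- of X₀ with the n-th sign changed to the neighbour of g X₀ with the (π n)-th
-- sign changed, for a bijection π of ℕ. Since g preserves the squares of the
-- hypercube, the same π describes g around every vertex of the component, so g
-- agrees there with the symplectic permutation ±(n + 1) ↦ ±(π n + 1), with signs
-- corrected so that X₀ is sent to g X₀.

module Submission where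

open import Defs
open import Data.Bool using (Bool; true; false; not; _xor_)
open import Data.Bool.Properties
  using (xor-assoc; xor-comm; xor-same; xor-identityʳ; not-involutive; not-injective; not-¬; not-distribʳ-xor)
open import Data.Empty using (⊥-elim)
open import Data.Integer using (+[1+_]; -[1+_])
open import Data.Nat using (ℕ; _≟_)
open import Data.Product using (Σ; _×_; _,_; proj₁; proj₂)
open import Data.Sum using (_⊎_; inj₁; inj₂)
open import Function.Base using (_∘_)
open import Function.Bundles using (_↔_; Inverse; mk↔ₛ′)
open import Level using (0ℓ)
open import Relation.Binary.Bundles using (Setoid)
open import Relation.Binary.Construct.Closure.ReflexiveTransitive using (Star; ε; _◅_)
open import Relation.Binary.PropositionalEquality
  using (_≡_; _≢_; refl; sym; trans; cong; cong₂; module ≡-Reasoning)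
open import Relation.Nullary using (does; yes; no)
open import Relation.Nullary.Decidable using (dec-true; dec-false)
import Relation.Binary.Reasoning.Setoid as SetoidReasoning

true≢false : true ≢ false
true≢false ()

xor-xor-cancelʳ : ∀ x y → (x xor y) xor y ≡ x
xor-xor-cancelʳ x y = trans (xor-assoc x y y) (trans (cong (x xor_) (xor-same y)) (xor-identityʳ x))

xor-cancelʳ-≡ : ∀ z {x y} → x xor z ≡ y xor z → x ≡ y
xor-cancelʳ-≡ z {true}  {true}  _ = refl
xor-cancelʳ-≡ z {false} {false} _ = refl
xor-cancelʳ-≡ z {true}  {false} h = ⊥-elim (not-¬ refl (sym h))
xor-cancelʳ-≡ z {false} {true}  h = ⊥-elim (not-¬ refl h)

-- Every i : NZ is ±(index i + 1).
index : NZ → ℕ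
index (+[1+ n ] , _) = n
index (-[1+ n ] , _) = n

isPos : NZ → Bool
isPos (+[1+ _ ] , _) = true
isPos (-[1+ _ ] , _) = false

signed : ℕ → Bool → NZ
signed n true  = +[1+ n ] , _
signed n false = -[1+ n ] , _

signed-index-isPos : ∀ i → signed (index i) (isPos i) ≡ i
signed-index-isPos (+[1+ _ ] , _) = refl
signed-index-isPos (-[1+ _ ] , _) = refl

index-signed : ∀ n e → index (signed n e) ≡ n
index-signed n true  = refl
index-signed n false = refl

isPos-signed : ∀ n e → isPos (signed n e) ≡ e
isPos-signed n true  = refl
isPos-signed n false = refl

negNZ-signed : ∀ n e → negNZ (signed n e) ≡ signed n (not e)
negNZ-signed n true  = refl
negNZ-signed n false = refl

index-negNZ : ∀ i → index (negNZ i) ≡ index i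
index-negNZ (+[1+ _ ] , _) = refl
index-negNZ (-[1+ _ ] , _) = refl

δ : ℕ → ℕ → Bool
δ k m = does (k ≟ m)

δ-diag : ∀ k → δ k k ≡ true
δ-diag k = dec-true (k ≟ k) refl

δ-≢ : ∀ {k m} → k ≢ m → δ k m ≡ false
δ-≢ {k} {m} = dec-false (k ≟ m)

δ-true⇒≡ : ∀ {k m} → δ k m ≡ true → k ≡ m
δ-true⇒≡ {k} {m} with k ≟ m
... | yes k≡m = λ _ → k≡m
... | no k≢m  = λ δkm≡true → ⊥-elim (true≢false (trans (sym δkm≡true) (dec-false (k ≟ m) k≢m)))

δ-cong-⇔ : ∀ {k m k' m'} → (k ≡ m → k' ≡ m') → (k' ≡ m' → k ≡ m) → δ k m ≡ δ k' m'
δ-cong-⇔ {k} {m} {k'} {m'} ⇒ ⇐ with k ≟ m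
... | yes k≡m = trans (dec-true (k ≟ m) k≡m) (sym (dec-true (k' ≟ m') (⇒ k≡m)))
... | no k≢m  = trans (dec-false (k ≟ m) k≢m) (sym (dec-false (k' ≟ m') (k≢m ∘ ⇐)))

δ-transport : (p : ℕ ↔ ℕ) → ∀ a m → δ a (Inverse.from p m) ≡ δ (Inverse.to p a) m
δ-transport p a m = δ-cong-⇔
  (λ a≡ρm → trans (cong (Inverse.to p) a≡ρm) (Inverse.strictlyInverseˡ p m))
  (λ πa≡m → trans (sym (Inverse.strictlyInverseʳ p a)) (cong (Inverse.from p) πa≡m))

-- Two walks p, k and q, k' (with q ≢ p) in the cube {0,1}^ℕ that end at the
-- same point either go around a square or the first returns to its start.
δ-square : ∀ {p q k k'} → p ≢ q → (∀ m → δ k m xor δ p m ≡ δ k' m xor δ q m) → k ≡ p ⊎ k ≡ q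
δ-square {p} {q} {k} {k'} p≢q h with k ≟ p | k ≟ q
... | yes k≡p | _       = inj₁ k≡p
... | no _    | yes k≡q = inj₂ k≡q
... | no k≢p  | no k≢q  = ⊥-elim (true≢false true≡false)
  where
  open ≡-Reasoning
  k'≡k : k' ≡ k
  k'≡k = δ-true⇒≡ (begin
    δ k' k              ≡⟨ sym (xor-identityʳ _) ⟩
    δ k' k xor false    ≡⟨ cong (δ k' k xor_) (δ-≢ (k≢q ∘ sym)) ⟨
    δ k' k xor δ q k    ≡⟨ h k ⟨
    δ k k xor δ p k     ≡⟨ cong₂ _xor_ (δ-diag k) (δ-≢ (k≢p ∘ sym)) ⟩
    true                ∎)
  true≡false : true ≡ false
  true≡false = begin
    true                ≡⟨ cong₂ _xor_ (δ-≢ k≢p) (δ-diag p) ⟨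
    δ k p xor δ p p     ≡⟨ h p ⟩
    δ k' p xor δ q p    ≡⟨ cong₂ _xor_ (cong (λ x → δ x p) k'≡k) (δ-≢ (p≢q ∘ sym)) ⟩
    δ k p xor false     ≡⟨ cong (_xor false) (δ-≢ k≢p) ⟩
    false               ∎

set-negNZ : (X : Vertex) → ∀ i → set X (negNZ i) ≡ not (set X i)
set-negNZ X i with set X i in Xi
... | true  = singular X i Xi
... | false with maximal X i
...   | inj₁ Xi≡true = ⊥-elim (true≢false (trans (sym Xi≡true) Xi))
...   | inj₂ X-i     = X-i

vertex : (A : Subset) → (∀ i → A (negNZ i) ≡ not (A i)) → Vertex
vertex A A-neg = record { set = A ; singular = singular′ ; maximal = maximal′ }
  where
  singular′ : ∀ i → A i ≡ true → A (negNZ i) ≡ false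
  singular′ i Ai = trans (A-neg i) (cong not Ai)
  maximal′ : ∀ i → A i ≡ true ⊎ A (negNZ i) ≡ true
  maximal′ i with A i in Ai
  ... | true  = inj₁ refl
  ... | false = inj₂ (trans (A-neg i) (cong not Ai))

σ : Vertex → ℕ → Bool
σ X n = set X (+[1+ n ] , _)

σ-injective : ∀ {X Y} → (∀ n → σ X n ≡ σ Y n) → X ≈V Y
σ-injective h (+[1+ n ] , _) = h n
σ-injective {X} {Y} h (-[1+ n ] , _) = begin
  set X (-[1+ n ] , _)   ≡⟨ set-negNZ X (+[1+ n ] , _) ⟩
  not (σ X n)            ≡⟨ cong not (h n) ⟩
  not (σ Y n)            ≡⟨ set-negNZ Y (+[1+ n ] , _) ⟨
  set Y (-[1+ n ] , _)   ∎
  where open ≡-Reasoning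

set-signed : (X : Vertex) → ∀ n e → set X (signed n e) ≡ not (e xor σ X n)
set-signed X n true  = sym (not-involutive (σ X n))
set-signed X n false = set-negNZ X (+[1+ n ] , _)

∈⇒σ-index : (X : Vertex) → ∀ i → set X i ≡ true → σ X (index i) ≡ isPos i
∈⇒σ-index X (+[1+ n ] , _) Xi = Xi
∈⇒σ-index X (-[1+ n ] , _) Xi = not-injective (trans (sym (set-negNZ X (+[1+ n ] , _))) Xi)

∉⇒σ-index : (X : Vertex) → ∀ i → set X i ≡ false → σ X (index i) ≡ not (isPos i)
∉⇒σ-index X (+[1+ n ] , _) Xi = Xi
∉⇒σ-index X (-[1+ n ] , _) Xi = not-injective (trans (sym (set-negNZ X (+[1+ n ] , _))) Xi)

-- The symplectic permutation ±(n + 1) ↦ ±(π n + 1), the sign being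
-- reversed exactly when b n = true.
module SignedPermutation (p : ℕ ↔ ℕ) (b : ℕ → Bool) where
  open Inverse p using () renaming (to to π; from to ρ)

  forward : NZ → NZ
  forward i = signed (π (index i)) (isPos i xor b (index i))

  backward : NZ → NZ
  backward j = signed (ρ (index j)) (isPos j xor b (ρ (index j)))

  forward-backward : ∀ j → forward (backward j) ≡ j
  forward-backward j
    rewrite index-signed (ρ (index j)) (isPos j xor b (ρ (index j)))
          | isPos-signed (ρ (index j)) (isPos j xor b (ρ (index j)))
          | Inverse.strictlyInverseˡ p (index j)
          | xor-xor-cancelʳ (isPos j) (b (ρ (index j)))
          = signed-index-isPos j

  backward-forward : ∀ i → backward (forward i) ≡ i
  backward-forward i
    rewrite index-signed (π (index i)) (isPos i xor b (index i))
          | isPos-signed (π (index i)) (isPos i xor b (index i))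
          | Inverse.strictlyInverseʳ p (index i)
          | xor-xor-cancelʳ (isPos i) (b (index i))
          = signed-index-isPos i

  permutation : NZ ↔ NZ
  permutation = mk↔ₛ′ forward backward forward-backward backward-forward

  symplectic : Symplectic permutation
  symplectic (+[1+ n ] , _) = trans (cong (signed (π n)) (sym (not-involutive (b n))))
                                    (sym (negNZ-signed (π n) (not (b n))))
  symplectic (-[1+ n ] , _) = sym (negNZ-signed (π n) (b n))

  index-backward : ∀ j → index (backward j) ≡ ρ (index j)
  index-backward j = index-signed (ρ (index j)) (isPos j xor b (ρ (index j)))

  set-backward : ∀ X Y → (∀ n → σ Y (π n) ≡ b n xor σ X n) → ∀ j → set Y j ≡ set X (backward j)
  set-backward X Y σY∘π j = begin
    set Y j                             ≡⟨ cong (set Y) (signed-index-isPos j) ⟨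
    set Y (signed m e)                  ≡⟨ set-signed Y m e ⟩
    not (e xor σ Y m)                   ≡⟨ cong (λ m′ → not (e xor σ Y m′)) (Inverse.strictlyInverseˡ p m) ⟨
    not (e xor σ Y (π (ρ m)))           ≡⟨ cong (λ x → not (e xor x)) (σY∘π (ρ m)) ⟩
    not (e xor (b (ρ m) xor σ X (ρ m))) ≡⟨ cong not (xor-assoc e (b (ρ m)) (σ X (ρ m))) ⟨
    not ((e xor b (ρ m)) xor σ X (ρ m)) ≡⟨ set-signed X (ρ m) (e xor b (ρ m)) ⟨
    set X (backward j)                  ∎
    where
    open ≡-Reasoning
    m : ℕ
    m = index j
    e : Bool
    e = isPos j

≈V-setoid : Setoid 0ℓ 0ℓ
≈V-setoid = record
  { Carrier       = Vertex
  ; _≈_           = _≈V_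
  ; isEquivalence = record
    { refl  = λ _ → refl
    ; sym   = λ X≈Y i → sym (X≈Y i)
    ; trans = λ X≈Y Y≈Z i → trans (X≈Y i) (Y≈Z i)
    }
  }

toggle : Vertex → ℕ → Vertex
toggle X k = vertex (λ i → δ k (index i) xor set X i) toggle-negNZ
  where
  toggle-negNZ : ∀ i → δ k (index (negNZ i)) xor set X (negNZ i) ≡ not (δ k (index i) xor set X i)
  toggle-negNZ i rewrite index-negNZ i | set-negNZ X i = sym (not-distribʳ-xor (δ k (index i)) (set X i))

toggle-cong : ∀ {X Y} k → X ≈V Y → toggle X k ≈V toggle Y k
toggle-cong k X≈Y i = cong (δ k (index i) xor_) (X≈Y i)

toggle-involutive : ∀ X k → toggle (toggle X k) k ≈V X
toggle-involutive X k i =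
  trans (sym (xor-assoc d d (set X i))) (cong (_xor set X i) (xor-same d))
  where
  d : Bool
  d = δ k (index i)

toggle-comm : ∀ X a b → toggle (toggle X a) b ≈V toggle (toggle X b) a
toggle-comm X a b i = begin
  dᵇ xor (dᵃ xor set X i)   ≡⟨ xor-assoc dᵇ dᵃ (set X i) ⟨
  (dᵇ xor dᵃ) xor set X i   ≡⟨ cong (_xor set X i) (xor-comm dᵇ dᵃ) ⟩
  (dᵃ xor dᵇ) xor set X i   ≡⟨ xor-assoc dᵃ dᵇ (set X i) ⟩
  dᵃ xor (dᵇ xor set X i)   ∎
  where
  open ≡-Reasoning
  dᵃ dᵇ : Bool
  dᵃ = δ a (index i)
  dᵇ = δ b (index i)

toggle-injective : ∀ X {a b} → toggle X a ≈V toggle X b → a ≡ b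
toggle-injective X {a} {b} h = sym (δ-true⇒≡ (begin
  δ b a   ≡⟨ xor-cancelʳ-≡ (σ X a) (h (+[1+ a ] , _)) ⟨
  δ a a   ≡⟨ δ-diag a ⟩
  true    ∎))
  where open ≡-Reasoning

toggle-square : ∀ X {p q k k'} → toggle (toggle X p) k ≈V toggle (toggle X q) k' →
                p ≢ q → k ≡ p ⊎ k ≡ q
toggle-square X {p} {q} {k} {k'} h p≢q = δ-square {k' = k'} p≢q λ m → xor-cancelʳ-≡ (σ X m) (begin
  (δ k m xor δ p m) xor σ X m     ≡⟨ xor-assoc (δ k m) (δ p m) (σ X m) ⟩
  δ k m xor (δ p m xor σ X m)     ≡⟨ h (+[1+ m ] , _) ⟩
  δ k' m xor (δ q m xor σ X m)    ≡⟨ xor-assoc (δ k' m) (δ q m) (σ X m) ⟨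
  (δ k' m xor δ q m) xor σ X m    ∎)
  where open ≡-Reasoning

toggle-toggle-≈⇒≡ : ∀ X {a k} → toggle (toggle X a) k ≈V X → a ≡ k
toggle-toggle-≈⇒≡ X {a} {k} h = toggle-injective X (begin
  toggle X a                       ≈⟨ toggle-involutive (toggle X a) k ⟨
  toggle (toggle (toggle X a) k) k ≈⟨ toggle-cong {toggle (toggle X a) k} {X} k h ⟩
  toggle X k                       ∎)
  where open SetoidReasoning ≈V-setoid

DiffOne-resp : ∀ {A A' B B' : Subset} → (∀ i → A i ≡ A' i) → (∀ i → B i ≡ B' i) →
               DiffOne A B → DiffOne A' B'
DiffOne-resp A≗A' B≗B' (a , Aa , Ba , unique) =
  a , trans (sym (A≗A' a)) Aa , trans (sym (B≗B' a)) Ba ,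
  λ b A'b B'b → unique b (trans (A≗A' b) A'b) (trans (B≗B' b) B'b)

Adj-resp : ∀ {X X' Y Y'} → X ≈V X' → Y ≈V Y' → Adj X Y → Adj X' Y'
Adj-resp X≈X' Y≈Y' (X∖Y , Y∖X) = DiffOne-resp X≈X' Y≈Y' X∖Y , DiffOne-resp Y≈Y' X≈X' Y∖X

DiffOne-toggle : ∀ X k → DiffOne (set X) (set (toggle X k))
DiffOne-toggle X k = a , Xa , toggle-a , unique
  where
  open ≡-Reasoning
  a : NZ
  a = signed k (σ X k)
  Xa : set X a ≡ true
  Xa = trans (set-signed X k (σ X k)) (cong not (xor-same (σ X k)))
  toggle-a : δ k (index a) xor set X a ≡ false
  toggle-a rewrite index-signed k (σ X k) | δ-diag k | Xa = refl
  unique : ∀ b → set X b ≡ true → δ k (index b) xor set X b ≡ false → b ≡ a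
  unique b Xb toggle-b = begin
    b                                  ≡⟨ signed-index-isPos b ⟨
    signed (index b) (isPos b)         ≡⟨ cong (signed (index b)) (∈⇒σ-index X b Xb) ⟨
    signed (index b) (σ X (index b))   ≡⟨ cong (λ n → signed n (σ X n)) k≡index ⟨
    a                                  ∎
    where
    k≡index : k ≡ index b
    k≡index = δ-true⇒≡ (xor-cancelʳ-≡ (set X b) (trans toggle-b (cong not (sym Xb))))

adjacent-toggle : ∀ X k → Adj X (toggle X k)
adjacent-toggle X k =
  DiffOne-toggle X k ,
  DiffOne-resp (λ _ → refl) (toggle-involutive X k) (DiffOne-toggle (toggle X k) k)

σ-off-difference : ∀ {X Y a} → (∀ b → set X b ≡ true → set Y b ≡ false → b ≡ a) →
                   ∀ {m} → m ≢ index a → σ Y m ≡ σ X m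
σ-off-difference {X} {Y} unique {m} m≢a with σ X m in Xm | σ Y m in Ym
... | true  | true  = refl
... | false | false = refl
... | true  | false = ⊥-elim (m≢a (cong index (unique (+[1+ m ] , _) Xm Ym)))
... | false | true  = ⊥-elim (m≢a (cong index (unique (-[1+ m ] , _)
                        (trans (set-negNZ X (+[1+ m ] , _)) (cong not Xm))
                        (trans (set-negNZ Y (+[1+ m ] , _)) (cong not Ym)))))

adjacent⇒toggle : ∀ X Y → Adj X Y → Σ ℕ λ k → Y ≈V toggle X k
adjacent⇒toggle X Y ((a , Xa , Ya , unique) , _) = index a , σ-injective {Y} {toggle X (index a)} agree
  where
  agree : ∀ m → σ Y m ≡ δ (index a) m xor σ X m
  agree m with index a ≟ m
  ... | yes refl = begin
    σ Y (index a)                           ≡⟨ ∉⇒σ-index Y a Ya ⟩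
    not (isPos a)                           ≡⟨ cong not (∈⇒σ-index X a Xa) ⟨
    not (σ X (index a))                     ≡⟨ cong (_xor σ X (index a)) (δ-diag (index a)) ⟨
    δ (index a) (index a) xor σ X (index a) ∎
    where open ≡-Reasoning
  ... | no a≢m = trans (σ-off-difference {X} {Y} unique (a≢m ∘ sym)) (cong (_xor σ X m) (sym (δ-≢ a≢m)))

toggle-image : (f : Vertex → Vertex) → (∀ X Y → Adj X Y → Adj (f X) (f Y)) →
               ∀ X n → Σ ℕ λ k → f (toggle X n) ≈V toggle (f X) k
toggle-image f f-adj X n = adjacent⇒toggle (f X) (f (toggle X n)) (f-adj X (toggle X n) (adjacent-toggle X n))

module _ (g : Automorphism) where

  to-reflects-≈V : ∀ {X Y} → to g X ≈V to g Y → X ≈V Y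
  to-reflects-≈V {X} {Y} h = begin
    X                ≈⟨ from-to g X ⟨
    from g (to g X)  ≈⟨ from-cong g h ⟩
    from g (to g Y)  ≈⟨ from-to g Y ⟩
    Y                ∎
    where open SetoidReasoning ≈V-setoid

  from-adj : ∀ X Y → Adj X Y → Adj (from g X) (from g Y)
  from-adj X Y h = adj-refl g (from g X) (from g Y)
    (Adj-resp {X} {to g (from g X)} {Y} {to g (from g Y)}
      (λ i → sym (to-from g X i)) (λ i → sym (to-from g Y i)) h)

  toggleBijection : Vertex → ℕ ↔ ℕ
  toggleBijection X = mk↔ₛ′ π ρ π-ρ ρ-π
    where
    open SetoidReasoning ≈V-setoid
    π-spec : ∀ n → Σ ℕ λ k → to g (toggle X n) ≈V toggle (to g X) k
    π-spec = toggle-image (to g) (adj-pres g) X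
    π : ℕ → ℕ
    π = proj₁ ∘ π-spec
    ρ-spec : ∀ m → Σ ℕ λ k → from g (toggle (to g X) m) ≈V toggle (from g (to g X)) k
    ρ-spec = toggle-image (from g) from-adj (to g X)
    ρ : ℕ → ℕ
    ρ = proj₁ ∘ ρ-spec
    toggle-ρ : ∀ m → toggle X (ρ m) ≈V from g (toggle (to g X) m)
    toggle-ρ m = begin
      toggle X (ρ m)                 ≈⟨ toggle-cong {from g (to g X)} {X} (ρ m) (from-to g X) ⟨
      toggle (from g (to g X)) (ρ m) ≈⟨ proj₂ (ρ-spec m) ⟨
      from g (toggle (to g X) m)     ∎
    π-ρ : ∀ m → π (ρ m) ≡ m
    π-ρ m = toggle-injective (to g X) (begin
      toggle (to g X) (π (ρ m))           ≈⟨ proj₂ (π-spec (ρ m)) ⟨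
      to g (toggle X (ρ m))               ≈⟨ to-cong g (toggle-ρ m) ⟩
      to g (from g (toggle (to g X) m))   ≈⟨ to-from g (toggle (to g X) m) ⟩
      toggle (to g X) m                   ∎)
    ρ-π : ∀ n → ρ (π n) ≡ n
    ρ-π n = toggle-injective X (begin
      toggle X (ρ (π n))                  ≈⟨ toggle-ρ (π n) ⟩
      from g (toggle (to g X) (π n))      ≈⟨ from-cong g (proj₂ (π-spec n)) ⟨
      from g (to g (toggle X n))          ≈⟨ from-to g (toggle X n) ⟩
      toggle X n                          ∎)

  to-toggle : ∀ X n → to g (toggle X n) ≈V toggle (to g X) (Inverse.to (toggleBijection X) n)
  to-toggle X n = proj₂ (toggle-image (to g) (adj-pres g) X n)

module Coherence (g : Automorphism) (π : ℕ → ℕ) where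
  open SetoidReasoning ≈V-setoid

  Coherent : Vertex → Set
  Coherent Y = ∀ k → to g (toggle Y k) ≈V toggle (to g Y) (π k)

  coherent-resp : ∀ {X Y} → X ≈V Y → Coherent X → Coherent Y
  coherent-resp {X} {Y} X≈Y coherent k = begin
    to g (toggle Y k)      ≈⟨ to-cong g (toggle-cong {X} {Y} k X≈Y) ⟨
    to g (toggle X k)      ≈⟨ coherent k ⟩
    toggle (to g X) (π k)  ≈⟨ toggle-cong {to g X} {to g Y} (π k) (to-cong g X≈Y) ⟩
    toggle (to g Y) (π k)  ∎

  coherent⇒injective : ∀ {Y} → Coherent Y → ∀ {a b} → π a ≡ π b → a ≡ b
  coherent⇒injective {Y} coherent {a} {b} πa≡πb = toggle-injective Y (to-reflects-≈V g (begin
    to g (toggle Y a)      ≈⟨ coherent a ⟩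
    toggle (to g Y) (π a)  ≡⟨ cong (toggle (to g Y)) πa≡πb ⟩
    toggle (to g Y) (π b)  ≈⟨ coherent b ⟨
    to g (toggle Y b)      ∎))

  -- W = toggle (toggle Y a) k is the fourth corner of a square through Y;
  -- its image is adjacent to the images of both of its neighbours
  -- toggle Y a and toggle Y k, which forces the index π k.
  coherent-toggle-≢ : ∀ {Y} → Coherent Y → ∀ {a k} → a ≢ k →
                      to g (toggle (toggle Y a) k) ≈V toggle (to g (toggle Y a)) (π k)
  coherent-toggle-≢ {Y} coherent {a} {k} a≢k =
    conclude (toggle-square (to g Y) {π a} {π k} {k₁} {k₂} square (a≢k ∘ coherent⇒injective coherent))
    where
    viaA : Σ ℕ λ k₁ → to g (toggle (toggle Y a) k) ≈V toggle (to g (toggle Y a)) k₁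
    viaA = toggle-image (to g) (adj-pres g) (toggle Y a) k
    viaK : Σ ℕ λ k₂ → to g (toggle (toggle Y k) a) ≈V toggle (to g (toggle Y k)) k₂
    viaK = toggle-image (to g) (adj-pres g) (toggle Y k) a
    k₁ k₂ : ℕ
    k₁ = proj₁ viaA
    k₂ = proj₁ viaK
    square : toggle (toggle (to g Y) (π a)) k₁ ≈V toggle (toggle (to g Y) (π k)) k₂
    square = begin
      toggle (toggle (to g Y) (π a)) k₁  ≈⟨ toggle-cong {to g (toggle Y a)} {toggle (to g Y) (π a)} k₁ (coherent a) ⟨
      toggle (to g (toggle Y a)) k₁      ≈⟨ proj₂ viaA ⟨
      to g (toggle (toggle Y a) k)       ≈⟨ to-cong g (toggle-comm Y a k) ⟩
      to g (toggle (toggle Y k) a)       ≈⟨ proj₂ viaK ⟩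
      toggle (to g (toggle Y k)) k₂      ≈⟨ toggle-cong {to g (toggle Y k)} {toggle (to g Y) (π k)} k₂ (coherent k) ⟩
      toggle (toggle (to g Y) (π k)) k₂  ∎
    conclude : k₁ ≡ π a ⊎ k₁ ≡ π k → to g (toggle (toggle Y a) k) ≈V toggle (to g (toggle Y a)) (π k)
    conclude (inj₂ k₁≡πk) = begin
      to g (toggle (toggle Y a) k)       ≈⟨ proj₂ viaA ⟩
      toggle (to g (toggle Y a)) k₁      ≡⟨ cong (toggle (to g (toggle Y a))) k₁≡πk ⟩
      toggle (to g (toggle Y a)) (π k)   ∎
    conclude (inj₁ k₁≡πa) = ⊥-elim (a≢k (toggle-toggle-≈⇒≡ Y (to-reflects-≈V g (begin
      to g (toggle (toggle Y a) k)       ≈⟨ proj₂ viaA ⟩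
      toggle (to g (toggle Y a)) k₁      ≡⟨ cong (toggle (to g (toggle Y a))) k₁≡πa ⟩
      toggle (to g (toggle Y a)) (π a)   ≈⟨ toggle-cong {to g (toggle Y a)} {toggle (to g Y) (π a)} (π a) (coherent a) ⟩
      toggle (toggle (to g Y) (π a)) (π a) ≈⟨ toggle-involutive (to g Y) (π a) ⟩
      to g Y                             ∎))))

  coherent-toggle : ∀ {Y} → Coherent Y → ∀ a → Coherent (toggle Y a)
  coherent-toggle {Y} coherent a k with a ≟ k
  ... | no a≢k   = coherent-toggle-≢ coherent a≢k
  ... | yes refl = begin
    to g (toggle (toggle Y a) a)          ≈⟨ to-cong g (toggle-involutive Y a) ⟩
    to g Y                                ≈⟨ toggle-involutive (to g Y) (π a) ⟨
    toggle (toggle (to g Y) (π a)) (π a)  ≈⟨ toggle-cong {to g (toggle Y a)} {toggle (to g Y) (π a)} (π a) (coherent a) ⟨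
    toggle (to g (toggle Y a)) (π a)      ∎

module Agreement (g : Automorphism) (p : ℕ ↔ ℕ) (b : ℕ → Bool) where
  open SignedPermutation p b
  open Coherence g (Inverse.to p)

  AgreesAt : Vertex → Set
  AgreesAt Y = ∀ j → set (to g Y) j ≡ image permutation (set Y) j

  agreesAt-resp : ∀ {X Y} → X ≈V Y → AgreesAt X → AgreesAt Y
  agreesAt-resp {X} {Y} X≈Y agrees j =
    trans (sym (to-cong g X≈Y j)) (trans (agrees j) (X≈Y (backward j)))

  agreesAt-toggle : ∀ {Y} → Coherent Y → AgreesAt Y → ∀ a → AgreesAt (toggle Y a)
  agreesAt-toggle {Y} coherent agrees a j = begin
    set (to g (toggle Y a)) j                          ≡⟨ coherent a j ⟩
    δ (Inverse.to p a) (index j) xor set (to g Y) j    ≡⟨ cong₂ _xor_ (δ-transport p a (index j)) (sym (agrees j)) ⟨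
    δ a (Inverse.from p (index j)) xor set Y (backward j) ≡⟨ cong (λ n → δ a n xor set Y (backward j)) (index-backward j) ⟨
    δ a (index (backward j)) xor set Y (backward j)    ∎
    where open ≡-Reasoning

  Invariant : Vertex → Set
  Invariant Y = Coherent Y × AgreesAt Y

  invariant-along : ∀ {X Y} → Star Adj X Y → Invariant X → Invariant Y
  invariant-along ε invariant = invariant
  invariant-along {X} (_◅_ {j = X′} X~X′ path) (coherent , agrees) = invariant-along path
    ( coherent-resp X′≈ (coherent-toggle coherent a)
    , agreesAt-resp X′≈ (agreesAt-toggle coherent agrees a))
    where
    a : ℕ
    a = proj₁ (adjacent⇒toggle X X′ X~X′)
    X′≈ : toggle X a ≈V X′
    X′≈ i = sym (proj₂ (adjacent⇒toggle X X′ X~X′) i)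

theorem1 : (g : Automorphism) (X₀ : Vertex) →
    Σ (NZ ↔ NZ) λ s → Symplectic s ×
      (∀ Y → Connected X₀ Y → ∀ j → set (to g Y) j ≡ image s (set Y) j)
theorem1 g X₀ = permutation , symplectic , λ Y path → proj₂ (invariant-along path (to-toggle g X₀ , agrees-X₀))
  where
  p : ℕ ↔ ℕ
  p = toggleBijection g X₀
  π : ℕ → ℕ
  π = Inverse.to p
  b : ℕ → Bool
  b n = σ (to g X₀) (π n) xor σ X₀ n
  open SignedPermutation p b
  open Agreement g p b
  agrees-X₀ : AgreesAt X₀
  agrees-X₀ = set-backward X₀ (to g X₀) λ n → sym (xor-xor-cancelʳ (σ (to g X₀) (π n)) (σ X₀ n))
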